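{- Let $G_\tau$ be a bidirected graph. If $G_\tau$ is all positive, then its transitive closure $\mathrm{Ft}(G_\tau)$ is all positive. If $G_\tau$ is balanced, then $\mathrm{Ft}(G_\tau)$ is balanced.
   Context: A graph $G=(V,E)$ is finite, with loops and multiple edges allowed. A half-edge is a pair $(e,x)$ with $e$ incident with $x$ (a loop has two half-edges at its vertex). A bidirected graph $G_\tau=(V,E;\tau)$ is a graph with a map $\tau$ assigning $+1$ or $-1$ to every half-edge; an edge with ends $x,y$ and $\tau(e,x)=\alpha,\tau(e,y)=\beta$ is written $\{x^\alpha,y^\beta\}$ and has sign $\sigma(e)=-\alpha\beta$. $G_\tau$ is all positive if every edge has sign $+1$, and balanced if every cycle has an even number of negative edges. A chain is $x_0,e_1,x_1,\ldots,e_k,x_k$ where $e_i$ has ends $x_{i-1},x_i$; when $e_i$ is traversed from $x_{i-1}$ to $x_i$, $\tau(e_i,x_{i-1}),\tau(e_i,x_i)$ denote the values at the corresponding half-edges. For $\alpha,\beta\in\{\pm1\}$ a b-walk from $x^\alpha$ to $y^\beta$ is a chain $x=x_0,e_1,\ldots,e_k,x_k=y$ with $k\ge1$, $\tau(e_1,x_0)=\alpha$, $\tau(e_k,x_k)=\beta$ and $\tau(e_i,x_i)+\tau(e_{i+1},x_i)=0$ for $1\le i\le k-1$. A b-path from $x^\alpha$ to $y^\beta$ is a b-walk from $x^\alpha$ to $y^\beta$ minimal with these properties (no b-walk from $x^\alpha$ to $y^\beta$ has as edge sequence a proper subsequence, in the same order, of its edge sequence); $x=y$ allowed. The transitive closure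 $\mathrm{Ft}(G_\tau)$ is the bidirected graph on $V$ whose edges are those of $G_\tau$ together with an edge $\{x^\alpha,y^\beta\}$ (a loop if $x=y$) for every $x^\alpha,y^\beta$ such that $G_\tau$ has a b-path from $x^\alpha$ to $y^\beta$. -}

module Defs where

open import Data.Bool using (Bool; true; false; not)
open import Data.Sign using (Sign; +; -; opposite; _*_)
open import Data.Sign.Properties using (_≟_)
open import Data.Product using (_×_; _,_; proj₁; ∃)
open import Data.List using (List; map; filter; length)
open import Data.List.NonEmpty using (List⁺; toList; head; last)
open import Data.List.Relation.Unary.Linked using (Linked)
open import Data.List.Relation.Unary.Unique.Propositional using (Unique)
open import Data.List.Relation.Binary.Sublist.Propositional using (_⊆_)
open import Data.Sum using (_⊎_; inj₁; inj₂)
open import Data.Nat using (ℕ)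
open import Data.Nat.Divisibility using (_∣_)
open import Relation.Binary.PropositionalEquality using (_≡_)

-- Every edge e has two half-edges, indexed by a side d : Bool;
-- 'end e d' is the vertex of that half-edge, 'τ e d' its value ±1.
-- A loop is an edge with end e false ≡ end e true (two half-edges at it).
-- Edge e is {x^α , y^β} with x = end e false, α = τ e false,
-- y = end e true, β = τ e true.
record BiGraph (V E : Set) : Set where
  field
    end : E → Bool → V
    τ   : E → Bool → Sign

module _ {V E : Set} (G : BiGraph V E) where
  open BiGraph G

  σ : E → Sign
  σ e = opposite (τ e false * τ e true)

  -- a step of a chain: an edge traversed starting from its half-edge d
  Step : Set
  Step = E × Bool

  edgeOf : Step → E
  edgeOf (e , d) = e

  from to : Step → V
  from (e , d) = end e d
  to   (e , d) = end e (not d)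

  τfrom τto : Step → Sign
  τfrom (e , d) = τ e d
  τto   (e , d) = τ e (not d)

  Consec : Step → Step → Set
  Consec s t = to s ≡ from t

  BConsec : Step → Step → Set
  BConsec s t = to s ≡ from t × τfrom t ≡ opposite (τto s)

  -- b-walk from x^α to y^β (non-empty list of steps, so k ≥ 1)
  record IsBWalk (x : V) (α : Sign) (y : V) (β : Sign) (w : List⁺ Step) : Set where
    field
      startV  : from (head w) ≡ x
      startτ  : τfrom (head w) ≡ α
      endV    : to (last w) ≡ y
      endτ    : τto (last w) ≡ β
      linked  : Linked BConsec (toList w)

  edgeSeq : List⁺ Step → List E
  edgeSeq w = map edgeOf (toList w)

  IsBPath : V → Sign → V → Sign → List⁺ Step → Set
  IsBPath x α y β w =
    IsBWalk x α y β w ×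
    (∀ w′ → IsBWalk x α y β w′ → edgeSeq w′ ⊆ edgeSeq w → edgeSeq w′ ≡ edgeSeq w)

  AllPositive : Set
  AllPositive = ∀ e → σ e ≡ +

  record IsCycle (w : List⁺ Step) : Set where
    field
      chain    : Linked Consec (toList w)
      closed   : to (last w) ≡ from (head w)
      edgesDistinct : Unique (map edgeOf (toList w))
      vertsDistinct : Unique (map from (toList w))

  negativeCount : List⁺ Step → ℕ
  negativeCount w = length (filter (λ s → σ (edgeOf s) ≟ -) (toList w))

  Balanced : Set
  Balanced = ∀ w → IsCycle w → 2 ∣ negativeCount w

  -- new edges of the transitive closure: one edge {x^α , y^β} for every
  -- x^α, y^β admitting a b-path (the witness is irrelevant, so there is
  -- exactly one such edge per quadruple up to ≡)
  record NewEdge : Set where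
    constructor newEdge
    field
      x : V
      α : Sign
      y : V
      β : Sign
      .hasBPath : ∃ (IsBPath x α y β)

  Ft : BiGraph V (E ⊎ NewEdge)
  Ft = record { end = endFt ; τ = τFt }
    where
      endFt : E ⊎ NewEdge → Bool → V
      endFt (inj₁ e) d = end e d
      endFt (inj₂ ne) false = NewEdge.x ne
      endFt (inj₂ ne) true  = NewEdge.y ne
      τFt : E ⊎ NewEdge → Bool → Sign
      τFt (inj₁ e) d = τ e d
      τFt (inj₂ ne) false = NewEdge.α ne
      τFt (inj₂ ne) true  = NewEdge.β ne

-- A b-walk from x^α to y^β is a walk from x to y whose product of edge signs telescopes, by the
-- half-edge condition at its inner vertices, to -αβ, the sign of the new edge {x^α, y^β}. So every
-- edge of Ft(G), traversed either way, is realised by a walk of G of the same sign, and a cycle of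
-- Ft(G) by a closed walk of G of the same sign. If G is all positive, every walk of G is positive.
-- If G is balanced, so is every closed walk: one that repeats a vertex, or an edge (necessarily
-- in the opposite direction), splits into two shorter closed walks whose signs multiply to its sign.

module Submission where

open import Defs
open import Data.Bool using (false; true)
open import Data.Fin using (Fin)
import Data.Fin.Properties as Fin
open import Data.Irrelevant as Irrelevant using (Irrelevant; [_])
open import Data.List using (List; []; _∷_; map; filter; length; foldr; initLast; _∷ʳ′_)
open import Data.List.NonEmpty using (List⁺; _∷_; toList; head; last)
open import Data.List.Relation.Unary.All using (All; []; _∷_; universal)
open import Data.List.Relation.Unary.All.Properties using (¬Any⇒All¬)
open import Data.List.Relation.Unary.Any using (Any; here; there)
import Data.List.Relation.Unary.Any.Properties as Any
open import Data.List.Relation.Unary.AllPairs using ([]; _∷_)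
open import Data.List.Relation.Unary.Linked as Linked using (Linked; [-]; _∷_)
open import Data.List.Relation.Unary.Unique.Propositional using (Unique)
import Data.List.Membership.DecPropositional as Membership
open import Data.Nat using (ℕ; zero; suc; _<_; z<s; s<s)
open import Data.Nat.Divisibility using (_∣_; divides; _∣?_)
open import Data.Nat.Induction using (<-wellFounded)
open import Data.Nat.Properties using (n<1+n; m<n⇒m<1+n)
open import Data.Product using (_×_; _,_; proj₁; ∃)
open import Data.Sign using (Sign; +; -; opposite; _*_)
open import Data.Sign.Properties
  using (_≟_; *-identityʳ; *-assoc; *-comm; s*s≡+; opposite-involutive; *-commutativeSemigroup)
open import Algebra.Properties.CommutativeSemigroup *-commutativeSemigroup using (x∙yz≈y∙xz)
open import Data.Sum using (_⊎_; inj₁; inj₂)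
open import Function using (_∘_)
open import Induction.WellFounded using (Acc; acc)
open import Relation.Binary.Definitions using (DecidableEquality)
open import Relation.Binary.PropositionalEquality
  using (_≡_; refl; sym; trans; cong; cong₂; module ≡-Reasoning)
open import Relation.Nullary using (yes; no; recompute)

-1^ : ℕ → Sign
-1^ zero = +
-1^ (suc n) = opposite (-1^ n)

2∣⇒-1^≡+ : ∀ {n} → 2 ∣ n → -1^ n ≡ +
2∣⇒-1^≡+ (divides zero refl) = refl
2∣⇒-1^≡+ (divides (suc q) refl) =
  trans (opposite-involutive _) (2∣⇒-1^≡+ (divides q refl))

-1^≡+⇒2∣ : ∀ n → -1^ n ≡ + → 2 ∣ n
-1^≡+⇒2∣ zero _ = divides 0 refl
-1^≡+⇒2∣ (suc (suc n)) eq with -1^≡+⇒2∣ n (trans (sym (opposite-involutive _)) eq)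
... | divides q refl = divides (suc q) refl

signProduct : List Sign → Sign
signProduct = foldr _*_ +

signProduct-map : ∀ {A : Set} (f : A → Sign) (xs : List A) →
  signProduct (map f xs) ≡ -1^ (length (filter (λ x → f x ≟ -) xs))
signProduct-map f [] = refl
signProduct-map f (x ∷ xs) with f x
... | + = signProduct-map f xs
... | - = cong opposite (signProduct-map f xs)

opposite-telescope : ∀ a b c → opposite (a * b) * opposite (opposite b * c) ≡ opposite (a * c)
opposite-telescope + + + = refl
opposite-telescope + + - = refl
opposite-telescope + - + = refl
opposite-telescope + - - = refl
opposite-telescope - + + = refl
opposite-telescope - + - = refl
opposite-telescope - - + = refl
opposite-telescope - - - = refl

last-∷ : ∀ {A : Set} (x y : A) (ys : List A) → last (x ∷ y ∷ ys) ≡ last (y ∷ ys)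
last-∷ x y ys with initLast ys
... | [] = refl
... | _ ∷ʳ′ _ = refl

module _ {V E : Set} (G : BiGraph V E) where

  infixr 5 _∷_ _++_

  data Walk : V → V → Set where
    []  : ∀ {a} → Walk a a
    _∷_ : ∀ {b} (s : Step G) → Walk (to G s) b → Walk (from G s) b

  private
    variable
      a b d : V

  steps : Walk a b → List (Step G)
  steps [] = []
  steps (s ∷ c) = s ∷ steps c

  stepSign : Step G → Sign
  stepSign s = σ G (edgeOf G s)

  sign : Walk a b → Sign
  sign c = signProduct (map stepSign (steps c))

  len : Walk a b → ℕ
  len c = length (steps c)

  _++_ : Walk a b → Walk b d → Walk a d
  [] ++ d = d
  (s ∷ c) ++ d = s ∷ (c ++ d)

  sign-++ : (c : Walk a b) (c′ : Walk b d) → sign (c ++ c′) ≡ sign c * sign c′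
  sign-++ [] c′ = refl
  sign-++ (s ∷ c) c′ =
    trans (cong (stepSign s *_) (sign-++ c c′)) (sym (*-assoc (stepSign s) (sign c) (sign c′)))

  cast : ∀ {a′ b′} → a ≡ a′ → b ≡ b′ → Walk a b → Walk a′ b′
  cast refl refl c = c

  sign-cast : ∀ {a′ b′} (p : a ≡ a′) (q : b ≡ b′) (c : Walk a b) → sign (cast p q c) ≡ sign c
  sign-cast refl refl c = refl

  cast-< : ∀ {a′ b′ n} (p : a ≡ a′) (q : b ≡ b′) (c : Walk a b) → len c < n → len (cast p q c) < n
  cast-< refl refl c lt = lt

  AllPositive⇒sign≡+ : AllPositive G → (c : Walk a b) → sign c ≡ +
  AllPositive⇒sign≡+ positive [] = refl
  AllPositive⇒sign≡+ positive ((e , _) ∷ c) rewrite positive e = AllPositive⇒sign≡+ positive c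

  reverseStep : (s : Step G) → Walk (to G s) (from G s)
  reverseStep (e , false) = (e , true) ∷ []
  reverseStep (e , true) = (e , false) ∷ []

  sign-reverseStep : (s : Step G) → sign (reverseStep s) ≡ stepSign s
  sign-reverseStep (e , false) = *-identityʳ (σ G e)
  sign-reverseStep (e , true) = *-identityʳ (σ G e)

  reverse : Walk a b → Walk b a
  reverse [] = []
  reverse (s ∷ c) = reverse c ++ reverseStep s

  sign-reverse : (c : Walk a b) → sign (reverse c) ≡ sign c
  sign-reverse [] = refl
  sign-reverse (s ∷ c) = begin
    sign (reverse c ++ reverseStep s)        ≡⟨ sign-++ (reverse c) (reverseStep s) ⟩
    sign (reverse c) * sign (reverseStep s)  ≡⟨ cong₂ _*_ (sign-reverse c) (sign-reverseStep s) ⟩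
    sign c * stepSign s                      ≡⟨ *-comm (sign c) (stepSign s) ⟩
    stepSign s * sign c                      ∎
    where open ≡-Reasoning

  Realisation : ∀ {E′} (H : BiGraph V E′) → Step H → Set
  Realisation H t = ∃ λ (c : Walk (from H t) (to H t)) → sign c ≡ σ H (edgeOf H t)

  concatRealisations : ∀ {E′} {H : BiGraph V E′} (w : List⁺ (Step H)) →
    Linked (Consec H) (toList w) → All (Realisation H) (toList w) →
    ∃ λ (c : Walk (from H (head w)) (to H (last w))) →
      sign c ≡ signProduct (map (σ H ∘ edgeOf H) (toList w))
  concatRealisations (t ∷ []) [-] ((c , sc) ∷ _) = c , trans sc (sym (*-identityʳ _))
  concatRealisations {H = H} (t ∷ u ∷ us) (t~u ∷ linked) ((c , sc) ∷ realisations)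
    with concatRealisations {H = H} (u ∷ us) linked realisations
  ... | d , sd =
    c ++ cast (sym t~u) lastEnd d ,
    trans (sign-++ c _) (cong₂ _*_ sc (trans (sign-cast (sym t~u) lastEnd d) sd))
    where
    lastEnd : to H (last (u ∷ us)) ≡ to H (last (t ∷ u ∷ us))
    lastEnd = cong (to H) (sym (last-∷ t u us))

  stepSign≡-ττ : (s : Step G) → stepSign s ≡ opposite (τfrom G s * τto G s)
  stepSign≡-ττ (e , false) = refl
  stepSign≡-ττ (e , true) = cong opposite (*-comm (BiGraph.τ G e false) (BiGraph.τ G e true))

  bWalk-signProduct : (w : List⁺ (Step G)) → Linked (BConsec G) (toList w) →
    signProduct (map stepSign (toList w)) ≡ opposite (τfrom G (head w) * τto G (last w))
  bWalk-signProduct (s ∷ []) _ = trans (*-identityʳ _) (stepSign≡-ττ s)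
  bWalk-signProduct (s ∷ t ∷ ts) ((_ , τt) ∷ linked) = begin
    stepSign s * signProduct (map stepSign (t ∷ ts))
      ≡⟨ cong₂ _*_ (stepSign≡-ττ s) (bWalk-signProduct (t ∷ ts) linked) ⟩
    opposite (τfrom G s * τto G s) * opposite (τfrom G t * τto G (last (t ∷ ts)))
      ≡⟨ cong (λ α → opposite (τfrom G s * τto G s) * opposite (α * τto G (last (t ∷ ts)))) τt ⟩
    opposite (τfrom G s * τto G s) * opposite (opposite (τto G s) * τto G (last (t ∷ ts)))
      ≡⟨ opposite-telescope (τfrom G s) (τto G s) _ ⟩
    opposite (τfrom G s * τto G (last (t ∷ ts)))
      ≡⟨ cong (λ u → opposite (τfrom G s * τto G u)) (sym (last-∷ s t ts)) ⟩
    opposite (τfrom G s * τto G (last (s ∷ t ∷ ts)))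
      ∎
    where open ≡-Reasoning

  bWalk⇒walk : ∀ {x α y β w} → IsBWalk G x α y β w →
    ∃ λ (c : Walk x y) → sign c ≡ opposite (α * β)
  bWalk⇒walk {α = α} {β = β} {w} bw =
    let c , sc = concatRealisations {H = G} w (Linked.map proj₁ linked)
                   (universal singleStep (toList w))
    in cast startV endV c , (begin
      sign (cast startV endV c)                     ≡⟨ sign-cast startV endV c ⟩
      sign c                                        ≡⟨ sc ⟩
      signProduct (map stepSign (toList w))         ≡⟨ bWalk-signProduct w linked ⟩
      opposite (τfrom G (head w) * τto G (last w))
        ≡⟨ cong₂ (λ α′ β′ → opposite (α′ * β′)) startτ endτ ⟩
      opposite (α * β)                              ∎)
    where
    open IsBWalk bw
    open ≡-Reasoning
    singleStep : (s : Step G) → Realisation G s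
    singleStep s = s ∷ [] , *-identityʳ (stepSign s)

  Realisation⇒σ≡+ : ∀ {E′} {H : BiGraph V E′} {t : Step H} → AllPositive G → Realisation H t →
    σ H (edgeOf H t) ≡ +
  Realisation⇒σ≡+ positive (c , sc) = trans (sym sc) (AllPositive⇒sign≡+ positive c)

  sameEdge : ∀ {s t : Step G} → edgeOf G s ≡ edgeOf G t →
    from G s ≡ from G t ⊎ (to G s ≡ from G t × to G t ≡ from G s)
  sameEdge {_ , false} {_ , false} refl = inj₁ refl
  sameEdge {_ , true}  {_ , true}  refl = inj₁ refl
  sameEdge {_ , false} {_ , true}  refl = inj₂ (refl , refl)
  sameEdge {_ , true}  {_ , false} refl = inj₂ (refl , refl)

  record SplitAt (c : Walk a b) (t : Step G) : Set where
    field
      before : Walk a (from G t)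
      after  : Walk (to G t) b
      sign-split : sign c ≡ sign before * (stepSign t * sign after)
      before<    : len before < len c
      after<     : len after < len c

  splitAny : ∀ {P : Step G → Set} (c : Walk a b) → Any P (steps c) → ∃ λ t → P t × SplitAt c t
  splitAny (s ∷ c) (here p) = s , p , record
    { before = [] ; after = c ; sign-split = refl ; before< = z<s ; after< = n<1+n (len c) }
  splitAny (s ∷ c) (there p) with splitAny c p
  ... | t , pt , sp = t , pt , record
    { before = s ∷ before
    ; after = after
    ; sign-split = trans (cong (stepSign s *_) sign-split) (sym (*-assoc (stepSign s) _ _))
    ; before< = s<s before<
    ; after< = m<n⇒m<1+n after<
    }
    where open SplitAt sp

  data Decomposition (c : Walk a b) : Set where
    simple : Unique (map (from G) (steps c)) → Unique (map (edgeOf G) (steps c)) →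
             Decomposition c
    split  : (c′ : Walk a b) {x : V} (z : Walk x x) → sign c ≡ sign z * sign c′ →
             len c′ < len c → len z < len c → Decomposition c

  vertexSplit : (s : Step G) {c : Walk (to G s) b} {t : Step G} →
    from G s ≡ from G t → SplitAt c t → Decomposition (s ∷ c)
  vertexSplit {b = b} s {c} {t} s~t sp =
    split shortcut loop signs
      (cast-< (sym s~t) refl (t ∷ after) (s<s after<))
      (cast-< refl (sym s~t) (s ∷ before) (s<s before<))
    where
    open SplitAt sp
    open ≡-Reasoning
    loop : Walk (from G s) (from G s)
    loop = cast refl (sym s~t) (s ∷ before)
    shortcut : Walk (from G s) b
    shortcut = cast (sym s~t) refl (t ∷ after)
    signs : sign (s ∷ c) ≡ sign loop * sign shortcut
    signs = begin
      stepSign s * sign c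
        ≡⟨ cong (stepSign s *_) sign-split ⟩
      stepSign s * (sign before * (stepSign t * sign after))
        ≡⟨ sym (*-assoc (stepSign s) (sign before) _) ⟩
      sign (s ∷ before) * sign (t ∷ after)
        ≡⟨ sym (cong₂ _*_ (sign-cast refl (sym s~t) (s ∷ before))
                          (sign-cast (sym s~t) refl (t ∷ after))) ⟩
      sign loop * sign shortcut
        ∎

  -- The step t traverses the edge of s backwards, so s and t cancel in the sign.
  edgeSplit : (s : Step G) {c : Walk (to G s) b} {t : Step G} → stepSign s ≡ stepSign t →
    to G s ≡ from G t → to G t ≡ from G s → SplitAt c t → Decomposition (s ∷ c)
  edgeSplit {b = b} s {c} {t} s≈t s→t t→s sp =
    split shortcut loop signs
      (cast-< t→s refl after (m<n⇒m<1+n after<))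
      (cast-< refl (sym s→t) before (m<n⇒m<1+n before<))
    where
    open SplitAt sp
    open ≡-Reasoning
    loop : Walk (to G s) (to G s)
    loop = cast refl (sym s→t) before
    shortcut : Walk (from G s) b
    shortcut = cast t→s refl after
    signs : sign (s ∷ c) ≡ sign loop * sign shortcut
    signs = begin
      stepSign s * sign c
        ≡⟨ cong (stepSign s *_) sign-split ⟩
      stepSign s * (sign before * (stepSign t * sign after))
        ≡⟨ x∙yz≈y∙xz (stepSign s) (sign before) _ ⟩
      sign before * (stepSign s * (stepSign t * sign after))
        ≡⟨ cong (λ σt → sign before * (stepSign s * (σt * sign after))) (sym s≈t) ⟩
      sign before * (stepSign s * (stepSign s * sign after))
        ≡⟨ cong (sign before *_) (sym (*-assoc (stepSign s) (stepSign s) (sign after))) ⟩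
      sign before * ((stepSign s * stepSign s) * sign after)
        ≡⟨ cong (λ σσ → sign before * (σσ * sign after)) (s*s≡+ (stepSign s)) ⟩
      sign before * sign after
        ≡⟨ sym (cong₂ _*_ (sign-cast refl (sym s→t) before) (sign-cast t→s refl after)) ⟩
      sign loop * sign shortcut
        ∎

  walk⇒chain : (s : Step G) (c : Walk a b) → to G s ≡ a →
    Linked (Consec G) (s ∷ steps c) × to G (last (s ∷ steps c)) ≡ b
  walk⇒chain s [] s→ = [-] , s→
  walk⇒chain s (t ∷ c) s→t with walk⇒chain t c refl
  ... | linked , end = s→t ∷ linked , trans (cong (to G) (last-∷ s t (steps c))) end

  module _ (_≟V_ : DecidableEquality V) (_≟E_ : DecidableEquality E) where
    open Membership _≟V_ using () renaming (_∈?_ to _∈V?_)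
    open Membership _≟E_ using () renaming (_∈?_ to _∈E?_)

    decompose : (c : Walk a b) → Decomposition c
    decompose [] = simple [] []
    decompose (s ∷ c) with decompose c
    ... | split c′ z signs c′< z< =
      split (s ∷ c′) z
        (trans (cong (stepSign s *_) signs) (x∙yz≈y∙xz (stepSign s) (sign z) (sign c′)))
        (s<s c′<) (m<n⇒m<1+n z<)
    ... | simple distinctVertices distinctEdges with edgeOf G s ∈E? map (edgeOf G) (steps c)
    ...   | yes e∈ = repeatedEdge (splitAny c (Any.map⁻ e∈))
      where
      repeatedEdge : ∃ (λ t → edgeOf G s ≡ edgeOf G t × SplitAt c t) → Decomposition (s ∷ c)
      repeatedEdge (t , s≈t , sp) with sameEdge s≈t
      ... | inj₁ s~t = vertexSplit s s~t sp
      ... | inj₂ (s→t , t→s) = edgeSplit s (cong (σ G) s≈t) s→t t→s sp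
    ...   | no e∉ with from G s ∈V? map (from G) (steps c)
    ...     | yes v∈ = let t , s~t , sp = splitAny c (Any.map⁻ v∈) in vertexSplit s s~t sp
    ...     | no v∉ =
      simple (¬Any⇒All¬ _ v∉ ∷ distinctVertices) (¬Any⇒All¬ _ e∉ ∷ distinctEdges)

    module _ (balanced : Balanced G) where

      cycle-sign≡+ : (c : Walk a a) → Unique (map (from G) (steps c)) →
        Unique (map (edgeOf G) (steps c)) → sign c ≡ +
      cycle-sign≡+ [] _ _ = refl
      cycle-sign≡+ (s ∷ c) distinctVertices distinctEdges
        with walk⇒chain s c refl
      ... | linked , closed =
        trans (signProduct-map stepSign (s ∷ steps c)) (2∣⇒-1^≡+ (balanced _ isCycle))
        where
        isCycle : IsCycle G (s ∷ steps c)
        isCycle = record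
          { chain = linked ; closed = closed
          ; edgesDistinct = distinctEdges ; vertsDistinct = distinctVertices }

      closedWalk-sign≡+ : (c : Walk a a) → sign c ≡ +
      closedWalk-sign≡+ c = go c (<-wellFounded (len c))
        where
        go : ∀ {a} (c : Walk a a) → Acc _<_ (len c) → sign c ≡ +
        go c (acc shorter) with decompose c
        ... | simple distinctVertices distinctEdges = cycle-sign≡+ c distinctVertices distinctEdges
        ... | split c′ z signs c′< z< =
          trans signs (cong₂ _*_ (go z (shorter z<)) (go c′ (shorter c′<)))

      realisations⇒2∣negativeCount : ∀ {E′} {H : BiGraph V E′} {w : List⁺ (Step H)} →
        IsCycle H w → All (Realisation H) (toList w) → 2 ∣ negativeCount H w
      realisations⇒2∣negativeCount {H = H} {w} isCycle realisations
        with concatRealisations {H = H} w (IsCycle.chain isCycle) realisations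
      ... | c , sc = -1^≡+⇒2∣ _ (begin
        -1^ (negativeCount H w)                         ≡⟨ sym (signProduct-map (σ H ∘ edgeOf H) (toList w)) ⟩
        signProduct (map (σ H ∘ edgeOf H) (toList w))  ≡⟨ sym sc ⟩
        sign c                                          ≡⟨ sym (sign-cast refl closed c) ⟩
        sign (cast refl closed c)                       ≡⟨ closedWalk-sign≡+ (cast refl closed c) ⟩
        +                                               ∎)
        where
        open IsCycle isCycle using (closed)
        open ≡-Reasoning

  bPath⇒walk : ∀ {x α y β} → ∃ (IsBPath G x α y β) →
    ∃ λ (c : Walk x y) → sign c ≡ opposite (α * β)
  bPath⇒walk (_ , isBWalk , _) = bWalk⇒walk isBWalk

  -- A new edge keeps its b-path irrelevantly, so its realisation is irrelevant too; the goals
  -- of Ft-allPositive and Ft-balanced are decidable, which lets recompute get past this.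
  realiseFtStep : (t : Step (Ft G)) → Irrelevant (Realisation (Ft G) t)
  realiseFtStep (inj₁ e , d) = [ (e , d) ∷ [] , *-identityʳ (σ G e) ]
  realiseFtStep (inj₂ (newEdge x α y β p) , false) = [ bPath⇒walk p ]
  realiseFtStep (inj₂ (newEdge x α y β p) , true) = [ reversed (bPath⇒walk p) ]
    where
    reversed : ∃ (λ (c : Walk x y) → sign c ≡ opposite (α * β)) →
      ∃ λ (c : Walk y x) → sign c ≡ opposite (α * β)
    reversed (c , sc) = reverse c , trans (sign-reverse c) sc

  realiseFtSteps : (ts : List (Step (Ft G))) → Irrelevant (All (Realisation (Ft G)) ts)
  realiseFtSteps [] = [ [] ]
  realiseFtSteps (t ∷ ts) = Irrelevant.zipWith _∷_ (realiseFtStep t) (realiseFtSteps ts)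

  Ft-allPositive : AllPositive G → AllPositive (Ft G)
  Ft-allPositive positive e with realiseFtStep (e , false)
  ... | [ realisation ] =
    recompute (σ (Ft G) e ≟ +) (Realisation⇒σ≡+ {H = Ft G} {e , false} positive realisation)

  Ft-balanced : DecidableEquality V → DecidableEquality E → Balanced G → Balanced (Ft G)
  Ft-balanced _≟V_ _≟E_ balanced w isCycle with realiseFtSteps (toList w)
  ... | [ realisations ] = recompute (2 ∣? negativeCount (Ft G) w)
    (realisations⇒2∣negativeCount _≟V_ _≟E_ balanced {H = Ft G} isCycle realisations)

proposition31 : ∀ {n m : ℕ} (G : BiGraph (Fin n) (Fin m)) →
    (AllPositive G → AllPositive (Ft G)) × (Balanced G → Balanced (Ft G))
proposition31 G = Ft-allPositive G , Ft-balanced G Fin._≟_ Fin._≟_
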